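{- Define rational numbers $\alpha^{(\ell)}_j, \beta^{(\ell)}_j$ for $\ell \ge 0$ and $1 \le j \le 3^{\ell+1}$ as follows. For $\ell = 0$: $$\alpha^{(0)}_1 = 1,\ \alpha^{(0)}_2 = -\tfrac{3}{2},\ \alpha^{(0)}_3 = \tfrac12,\qquad \beta^{(0)}_1 = 1,\ \beta^{(0)}_2 = 2,\ \beta^{(0)}_3 = -\tfrac14.$$ For $\ell \ge 1$: $\alpha^{(\ell)}_1 = 1$, $\alpha^{(\ell)}_2 = -2$, $\alpha^{(\ell)}_3 = 1$, $\beta^{(\ell)}_1 = 1$, $\beta^{(\ell)}_2 = 2$, $\beta^{(\ell)}_3 = 1$, and for $k = 0, 1, \ldots, 3^\ell - 2$: $$\alpha^{(\ell)}_{3k+4} = 1,\quad \beta^{(\ell)}_{3k+4} = \frac{\beta^{(\ell-1)}_{k+2}}{\beta^{(\ell)}_{3k+3}\,\beta^{(\ell)}_{3k+2}},\quad \beta^{(\ell)}_{3k+5} = 2 - \beta^{(\ell)}_{3k+4},$$ $$\alpha^{(\ell)}_{3k+5} = -1 - \frac{\alpha^{(\ell-1)}_{k+2} + 1 - \alpha^{(\ell)}_{3k+2}\,\beta^{(\ell)}_{3k+4}}{\beta^{(\ell)}_{3k+5}},\quad \alpha^{(\ell)}_{3k+6} = -1 - \alpha^{(\ell)}_{3k+5},\quad \beta^{(\ell)}_{3k+6} = -1 - \alpha^{(\ell)}_{3k+5}\,\alpha^{(\ell)}_{3k+6}.$$ Then all these numbers are well defined and, for every $\ell \ge 0$ and $j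 = 1, \ldots, 3^{\ell+1}$: (a) $\nu_2(\alpha^{(\ell)}_j) = -1$ if and only if $j = (3^{\ell+1}+1)/2$ or $j = (3^{\ell+1}+3)/2$; otherwise $\alpha^{(\ell)}_j \ne 0$ and $\nu_2(\alpha^{(\ell)}_j) \ge 0$; (b) $\nu_2(\beta^{(\ell)}_2) = 1$; $\nu_2(\beta^{(\ell)}_j) = -2$ if and only if $j = (3^{\ell+1}+3)/2$; and $\nu_2(\beta^{(\ell)}_j) = 0$ for all other $j$. As a consequence, $\beta^{(\ell)}_j \ne 0$ for all $\ell \ge 0$ and $j = 1, 2, \ldots, 3^{\ell+1}$.
   Context: For a nonzero rational number $x$, $\nu_2(x)$ denotes its $2$-adic valuation (the exponent of $2$ in its prime factorization), and $\nu_2(0) = +\infty$. -}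

module Defs where

open import Data.Nat as ℕ using (ℕ; zero; suc; _%_; _/_)
open import Data.Integer as ℤ using (ℤ; +_; +0; +[1+_]; -[1+_])
open import Data.Rational as ℚ using (ℚ; mkℚ; 0ℚ; 1ℚ; _÷_; ↧ₙ_)
open import Data.Maybe using (Maybe; just; nothing)

v2 : ℕ → ℕ → ℕ
v2 zero    n = 0
v2 (suc f) n with n % 2
... | zero  = suc (v2 f (n / 2))
... | suc _ = 0

-- For n ≥ 1, ν₂(n) ≤ n, so fuel n suffices.
ν₂ℕ : ℕ → ℕ
ν₂ℕ n = v2 n n

-- ν₂ : ℚ → ℤ ∪ {+∞}, with `nothing` standing for +∞ (the value at 0).
-- For x = n/d in lowest terms (d > 0), ν₂(x) = ν₂(|n|) - ν₂(d).
ν₂ : ℚ → Maybe ℤ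
ν₂ (mkℚ +0        _ _) = nothing
ν₂ p@(mkℚ +[1+ n ] _ _) = just (+ ν₂ℕ (suc n) ℤ.- + ν₂ℕ (↧ₙ p))
ν₂ p@(mkℚ -[1+ n ] _ _) = just (+ ν₂ℕ (suc n) ℤ.- + ν₂ℕ (↧ₙ p))

-- Total division on ℚ (x / 0 := 0).  Only used where the theorem itself
-- asserts the denominators are nonzero (all β's are nonzero).

_/'_ : ℚ → ℚ → ℚ
p /' mkℚ +0 _ _ = 0ℚ
p /' q@(mkℚ +[1+ _ ] _ _) = p ÷ q
p /' q@(mkℚ -[1+ _ ] _ _) = p ÷ q

-- The sequences α^{(ℓ)}_j, β^{(ℓ)}_j.
-- A block m (m ≥ 0) stores the entries with indices 3m+1, 3m+2, 3m+3.

record Blk : Set where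
  constructor blk
  field
    a₁ a₂ a₃ b₁ b₂ b₃ : ℚ
open Blk public

q : ℤ → ℕ → ℚ
q n d = ℚ._/_ n (suc d)

aAt bAt : Blk → ℕ → ℚ
aAt B 0 = a₁ B
aAt B 1 = a₂ B
aAt B _ = a₃ B
bAt B 0 = b₁ B
bAt B 1 = b₂ B
bAt B _ = b₃ B

αAt βAt : (ℕ → Blk) → ℕ → ℚ
αAt F j = aAt (F ((j ℕ.∸ 1) / 3)) ((j ℕ.∸ 1) % 3)
βAt F j = bAt (F ((j ℕ.∸ 1) / 3)) ((j ℕ.∸ 1) % 3)

blk0 : Blk
blk0 = blk 1ℚ (q (ℤ.- (+ 3)) 1) (q (+ 1) 1) 1ℚ (q (+ 2) 0) (q (ℤ.- (+ 1)) 3)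

blkBase : Blk
blkBase = blk 1ℚ (q (ℤ.- (+ 2)) 0) 1ℚ 1ℚ (q (+ 2) 0) 1ℚ

-- The recursion step: from block k (indices 3k+1..3k+3) of level ℓ and the
-- values a' = α^{(ℓ-1)}_{k+2}, b' = β^{(ℓ-1)}_{k+2}, produce block k+1
-- (indices 3k+4, 3k+5, 3k+6).
step : Blk → ℚ → ℚ → Blk
step B a' b' = blk α4 α5 α6 β4 β5 β6
  where
  β4 = b' /' (b₃ B ℚ.* b₂ B)
  α4 = 1ℚ
  β5 = q (+ 2) 0 ℚ.- β4
  α5 = ℚ.- 1ℚ ℚ.- ((a' ℚ.+ 1ℚ ℚ.- a₂ B ℚ.* β4) /' β5)
  α6 = ℚ.- 1ℚ ℚ.- α5
  β6 = ℚ.- 1ℚ ℚ.- α5 ℚ.* α6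

levels : ℕ → ℕ → Blk
levels zero    m       = blk0
levels (suc ℓ) zero    = blkBase
levels (suc ℓ) (suc k) =
  step (levels (suc ℓ) k) (αAt (levels ℓ) (k ℕ.+ 2)) (βAt (levels ℓ) (k ℕ.+ 2))

-- α ℓ j = α^{(ℓ)}_j and β ℓ j = β^{(ℓ)}_j, meaningful for 1 ≤ j ≤ 3^{ℓ+1}.
α β : ℕ → ℕ → ℚ
α ℓ j = αAt (levels ℓ) j
β ℓ j = βAt (levels ℓ) j

-- Every α and β is a fraction n/d with n and d in fixed residue classes: "integral"
-- (3a+1)/(6b+1), "unit" (6a+1)/(6b+1), "half" (6a+c)/(12b+2) with c ∈ {1, 3}, and
-- "quarter" (6a+5)/(24b+4), whose 2-adic valuations are ≥ 0, 0, -1 and -2.  Each block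
-- α, β_{3k+4..3k+6} is computed from the block before it and from α, β_{k+2} of the
-- previous level.  A generic block (α's integral, β's units) fed by a generic entry is
-- again generic.  The entry M₁ of the previous level (α half, β unit) produces the middle
-- block (α's halves, last β a quarter), and the entry M₂ (α half, β quarter) returns to
-- generic blocks: a quotient of quarters is a unit, and x + 1 - y is integral for halves
-- x, y with the same c.  The residues mod 3 are what keep every class closed, e.g. under
-- β ↦ 2 - β and α ↦ -1 - α(-1 - α).

module Submission where

open import Defs
open import Relation.Binary.PropositionalEquality
  using (_≡_; _≢_; refl; sym; trans; cong; cong₂; subst; subst₂; module ≡-Reasoning)
open import Data.Empty using (⊥-elim)
open import Data.Maybe using (just)
open import Data.Product using (∃; ∃₂; _×_; _,_; proj₁; proj₂)
open import Relation.Nullary using (¬_; yes; no)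

module Fractions where
  open import Data.Integer using (ℤ; +_; +[1+_]; -[1+_]; _+_; _*_; -_; _-_; ≢-nonZero)
  import Data.Integer.Properties as ℤP
  open import Data.Integer.Tactic.RingSolver using (solve-∀)
  open import Data.Rational as ℚ using (ℚ; mkℚ; ↥_; ↧_; 1ℚ)
  import Data.Rational.Properties as ℚP
  import Data.Rational.Unnormalised as ℚᵘ

  -- The denominator d may be negative and need not be coprime to n.
  infix 4 _≐_⁄_
  record _≐_⁄_ (x : ℚ) (n d : ℤ) : Set where
    constructor cross
    field cross-eq : ↥ x * d ≡ n * ↧ x

  ≐-resp : ∀ {x n n′ d d′} → n ≡ n′ → d ≡ d′ → x ≐ n ⁄ d → x ≐ n′ ⁄ d′
  ≐-resp refl refl r = r

  ↧≢0 : ∀ x → ↧ x ≢ + 0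
  ↧≢0 (mkℚ _ _ _) ()

  numerator≢0 : ∀ {x n d} → x ≐ n ⁄ d → n ≢ + 0 → ↥ x ≢ + 0
  numerator≢0 {x} {n} {d} (cross eq) n≢0 ↥x≡0 =
    n≢0 (ℤP.*-cancelʳ-≡ n (+ 0) (↧ x) {{≢-nonZero (↧≢0 x)}} (begin
      n * ↧ x   ≡⟨ sym eq ⟩
      ↥ x * d   ≡⟨ cong (_* d) ↥x≡0 ⟩
      + 0       ∎))
    where open ≡-Reasoning

  denominator≢0 : ∀ {x n d} → x ≐ n ⁄ d → n ≢ + 0 → d ≢ + 0
  denominator≢0 {x} {n} {d} (cross eq) n≢0 refl =
    n≢0 (ℤP.*-cancelʳ-≡ n (+ 0) (↧ x) {{≢-nonZero (↧≢0 x)}} (trans (sym eq) (ℤP.*-zeroʳ (↥ x))))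

  ≐-transfer : ∀ {x N D n d} → D ≢ + 0 → N * d ≡ n * D → x ≐ N ⁄ D → x ≐ n ⁄ d
  ≐-transfer {x} {N} {D} {n} {d} D≢0 Nd≡nD (cross eq) =
    cross (ℤP.*-cancelʳ-≡ _ _ D {{≢-nonZero D≢0}} (begin
      ↥ x * d * D     ≡⟨ swap (↥ x) d D ⟩
      ↥ x * D * d     ≡⟨ cong (_* d) eq ⟩
      N * ↧ x * d     ≡⟨ swap N (↧ x) d ⟩
      N * d * ↧ x     ≡⟨ cong (_* ↧ x) Nd≡nD ⟩
      n * D * ↧ x     ≡⟨ swap n D (↧ x) ⟩
      n * ↧ x * D     ∎))
    where
    open ≡-Reasoning
    swap : ∀ a b c → a * b * c ≡ a * c * b
    swap = solve-∀

  ≐-cancel : ∀ {x n d} k → k ≢ + 0 → x ≐ k * n ⁄ k * d → x ≐ n ⁄ d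
  ≐-cancel {x} {n} {d} k k≢0 (cross eq) =
    cross (ℤP.*-cancelˡ-≡ k _ _ {{≢-nonZero k≢0}} (begin
      k * (↥ x * d)   ≡⟨ shuffle k (↥ x) d ⟩
      ↥ x * (k * d)   ≡⟨ eq ⟩
      k * n * ↧ x     ≡⟨ ℤP.*-assoc k n (↧ x) ⟩
      k * (n * ↧ x)   ∎))
    where
    open ≡-Reasoning
    shuffle : ∀ a b c → a * (b * c) ≡ b * (a * c)
    shuffle = solve-∀

  ≐-+ : ∀ {x y n₁ d₁ n₂ d₂} → x ≐ n₁ ⁄ d₁ → y ≐ n₂ ⁄ d₂ →
        x ℚ.+ y ≐ n₁ * d₂ + n₂ * d₁ ⁄ d₁ * d₂
  ≐-+ {x@(mkℚ _ _ _)} {y@(mkℚ _ _ _)} {n₁} {d₁} {n₂} {d₂} (cross eq₁) (cross eq₂) =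
    ≐-transfer (λ ()) lemma canonical
    where
    open ≡-Reasoning
    canonical : x ℚ.+ y ≐ ↥ x * ↧ y + ↥ y * ↧ x ⁄ ↧ x * ↧ y
    canonical with ℚP.toℚᵘ-homo-+ x y
    ... | ℚᵘ.*≡* eq = cross (trans (cong (_* (↧ x * ↧ y)) (sym (ℚP.↥ᵘ-toℚᵘ (x ℚ.+ y))))
                            (trans eq (cong ((↥ x * ↧ y + ↥ y * ↧ x) *_) (ℚP.↧ᵘ-toℚᵘ (x ℚ.+ y)))))
    expand : ∀ a b c d e f → (a * b + c * d) * (e * f) ≡ a * e * (b * f) + c * f * (d * e)
    expand = solve-∀
    collect : ∀ a b c d e f → a * b * (c * d) + e * c * (b * f) ≡ (a * d + e * f) * (b * c)
    collect = solve-∀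
    lemma : (↥ x * ↧ y + ↥ y * ↧ x) * (d₁ * d₂) ≡ (n₁ * d₂ + n₂ * d₁) * (↧ x * ↧ y)
    lemma = begin
      (↥ x * ↧ y + ↥ y * ↧ x) * (d₁ * d₂)           ≡⟨ expand (↥ x) (↧ y) (↥ y) (↧ x) d₁ d₂ ⟩
      ↥ x * d₁ * (↧ y * d₂) + ↥ y * d₂ * (↧ x * d₁)  ≡⟨ cong₂ (λ u v → u * (↧ y * d₂) + v * (↧ x * d₁)) eq₁ eq₂ ⟩
      n₁ * ↧ x * (↧ y * d₂) + n₂ * ↧ y * (↧ x * d₁)  ≡⟨ collect n₁ (↧ x) (↧ y) d₂ n₂ d₁ ⟩
      (n₁ * d₂ + n₂ * d₁) * (↧ x * ↧ y)              ∎

  ≐-* : ∀ {x y n₁ d₁ n₂ d₂} → x ≐ n₁ ⁄ d₁ → y ≐ n₂ ⁄ d₂ → x ℚ.* y ≐ n₁ * n₂ ⁄ d₁ * d₂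
  ≐-* {x@(mkℚ _ _ _)} {y@(mkℚ _ _ _)} {n₁} {d₁} {n₂} {d₂} (cross eq₁) (cross eq₂) =
    ≐-transfer (λ ()) lemma canonical
    where
    open ≡-Reasoning
    canonical : x ℚ.* y ≐ ↥ x * ↥ y ⁄ ↧ x * ↧ y
    canonical with ℚP.toℚᵘ-homo-* x y
    ... | ℚᵘ.*≡* eq = cross (trans (cong (_* (↧ x * ↧ y)) (sym (ℚP.↥ᵘ-toℚᵘ (x ℚ.* y))))
                            (trans eq (cong ((↥ x * ↥ y) *_) (ℚP.↧ᵘ-toℚᵘ (x ℚ.* y)))))
    interchange : ∀ a b c d → a * b * (c * d) ≡ a * c * (b * d)
    interchange = solve-∀
    lemma : ↥ x * ↥ y * (d₁ * d₂) ≡ n₁ * n₂ * (↧ x * ↧ y)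
    lemma = begin
      ↥ x * ↥ y * (d₁ * d₂)       ≡⟨ interchange (↥ x) (↥ y) d₁ d₂ ⟩
      ↥ x * d₁ * (↥ y * d₂)       ≡⟨ cong₂ _*_ eq₁ eq₂ ⟩
      n₁ * ↧ x * (n₂ * ↧ y)       ≡⟨ interchange n₁ (↧ x) n₂ (↧ y) ⟩
      n₁ * n₂ * (↧ x * ↧ y)       ∎

  ≐-neg : ∀ {x n d} → x ≐ n ⁄ d → ℚ.- x ≐ - n ⁄ d
  ≐-neg {x} {n} {d} (cross eq) = cross (begin
    ↥ (ℚ.- x) * d     ≡⟨ cong (_* d) (ℚP.↥-neg x) ⟩
    - ↥ x * d         ≡⟨ sym (ℤP.neg-distribˡ-* (↥ x) d) ⟩
    - (↥ x * d)       ≡⟨ cong -_ eq ⟩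
    - (n * ↧ x)       ≡⟨ ℤP.neg-distribˡ-* n (↧ x) ⟩
    - n * ↧ x         ≡⟨ cong (- n *_) (sym (ℚP.↧-neg x)) ⟩
    - n * ↧ (ℚ.- x)   ∎)
    where open ≡-Reasoning

  ≐-invert : ∀ {y z n d} → n ≢ + 0 → y ≐ n ⁄ d → z ≐ ↧ y ⁄ ↥ y → z ≐ d ⁄ n
  ≐-invert {y} {n = n} {d} n≢0 y≐@(cross eq) =
    ≐-transfer (numerator≢0 y≐ n≢0) (trans (ℤP.*-comm (↧ y) n) (trans (sym eq) (ℤP.*-comm (↥ y) d)))

  -- 1/ y ≐ ↧ y ⁄ ↥ y holds by computation once the sign of y is known.
  ≐-/′ : ∀ {x y n₁ d₁ n₂ d₂} → x ≐ n₁ ⁄ d₁ → y ≐ n₂ ⁄ d₂ → n₂ ≢ + 0 → x /' y ≐ n₁ * d₂ ⁄ d₁ * n₂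
  ≐-/′ {y = mkℚ (+ 0) _ _} _ y≐ n₂≢0 = ⊥-elim (numerator≢0 y≐ n₂≢0 refl)
  ≐-/′ {y = mkℚ +[1+ _ ] _ _} x≐ y≐ n₂≢0 = ≐-* x≐ (≐-invert n₂≢0 y≐ (cross refl))
  ≐-/′ {y = mkℚ -[1+ _ ] _ _} x≐ y≐ n₂≢0 = ≐-* x≐ (≐-invert n₂≢0 y≐ (cross refl))

  2ℚ : ℚ
  2ℚ = q (+ 2) 0

  reflect : ℚ → ℚ
  reflect x = ℚ.- 1ℚ ℚ.- x

  ≐-1 : 1ℚ ≐ + 1 ⁄ + 1
  ≐-1 = cross refl

  ≐-2 : 2ℚ ≐ + 2 ⁄ + 1
  ≐-2 = cross refl

  ≐-reflect : ∀ {x n d} → x ≐ n ⁄ d → reflect x ≐ - d - n ⁄ d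
  ≐-reflect {n = n} {d} x≐ = ≐-resp (lemma n d) (ℤP.*-identityˡ d) (≐-+ (≐-neg ≐-1) (≐-neg x≐))
    where
    lemma : ∀ n d → - + 1 * d + - n * + 1 ≡ - d - n
    lemma = solve-∀

  ≐-2- : ∀ {x n d} → x ≐ n ⁄ d → 2ℚ ℚ.- x ≐ + 2 * d - n ⁄ d
  ≐-2- {n = n} {d} x≐ = ≐-resp (lemma n d) (ℤP.*-identityˡ d) (≐-+ ≐-2 (≐-neg x≐))
    where
    lemma : ∀ n d → + 2 * d + - n * + 1 ≡ + 2 * d - n
    lemma = solve-∀

  ≐-+1- : ∀ {x y n₁ d₁ n₂ d₂} → x ≐ n₁ ⁄ d₁ → y ≐ n₂ ⁄ d₂ →
          x ℚ.+ 1ℚ ℚ.- y ≐ (n₁ + d₁) * d₂ - n₂ * d₁ ⁄ d₁ * d₂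
  ≐-+1- {n₁ = n₁} {d₁} {n₂} {d₂} x≐ y≐ =
    ≐-resp (numerator n₁ d₁ n₂ d₂) (denominator d₁ d₂) (≐-+ (≐-+ x≐ ≐-1) (≐-neg y≐))
    where
    numerator : ∀ n₁ d₁ n₂ d₂ → (n₁ * + 1 + + 1 * d₁) * d₂ + - n₂ * (d₁ * + 1) ≡ (n₁ + d₁) * d₂ - n₂ * d₁
    numerator = solve-∀
    denominator : ∀ d₁ d₂ → d₁ * + 1 * d₂ ≡ d₁ * d₂
    denominator = solve-∀

  -- β_{3k+6} as a function of α_{3k+5}
  quadratic : ℚ → ℚ
  quadratic x = reflect (x ℚ.* reflect x)

  ≐-quadratic : ∀ {x n d} → x ≐ n ⁄ d → quadratic x ≐ n * n + n * d - d * d ⁄ d * d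
  ≐-quadratic {n = n} {d} x≐ = ≐-resp (lemma n d) refl (≐-reflect (≐-* x≐ (≐-reflect x≐)))
    where
    lemma : ∀ n d → - (d * d) - n * (- d - n) ≡ n * n + n * d - d * d
    lemma = solve-∀

module TwoAdicOrder where
  open import Data.Nat
  open import Data.Nat.Properties
  open import Data.Nat.Divisibility
  open import Data.Nat.DivMod using (m*n%n≡0; m*n/n≡m)
  open import Data.Nat.Primality using (euclidsLemma; prime?)
  open import Data.Nat.Induction using (<-wellFounded)
  open import Data.Nat.Tactic.RingSolver using (solve-∀)
  open import Induction.WellFounded using (Acc; acc)
  open import Relation.Nullary.Decidable using (from-yes)
  open import Data.Sum using ([_,_])

  n<2^n : ∀ n → n < 2 ^ n
  n<2^n zero    = s≤s z≤n
  n<2^n (suc n) = subst (suc n <_) (cong (2 ^ n +_) (sym (+-identityʳ (2 ^ n))))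
                        (+-mono-≤ (m^n>0 2 n) (n<2^n n))

  odd*odd : ∀ {m n} → ¬ 2 ∣ m → ¬ 2 ∣ n → ¬ 2 ∣ m * n
  odd*odd {m} {n} m-odd n-odd 2∣mn = [ m-odd , n-odd ] (euclidsLemma m n (from-yes (prime? 2)) 2∣mn)

  v2-odd : ∀ f {m} → ¬ 2 ∣ m → v2 (suc f) m ≡ 0
  v2-odd f {m} m-odd with m % 2 in eq
  ... | zero  = ⊥-elim (m-odd (m%n≡0⇒n∣m m 2 eq))
  ... | suc _ = refl

  v2-even : ∀ f n → n % 2 ≡ 0 → v2 (suc f) n ≡ suc (v2 f (n / 2))
  v2-even f n n-even with n % 2
  ... | zero = refl

  v2-double : ∀ f m → v2 (suc f) (2 * m) ≡ suc (v2 f m)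
  v2-double f m = begin
    v2 (suc f) (2 * m)        ≡⟨ cong (v2 (suc f)) (*-comm 2 m) ⟩
    v2 (suc f) (m * 2)        ≡⟨ v2-even f (m * 2) (m*n%n≡0 m 2) ⟩
    suc (v2 f (m * 2 / 2))    ≡⟨ cong (λ h → suc (v2 f h)) (m*n/n≡m m 2) ⟩
    suc (v2 f m)              ∎
    where open ≡-Reasoning

  v2-2^k*odd : ∀ k f {m} → k < f → ¬ 2 ∣ m → v2 f (2 ^ k * m) ≡ k
  v2-2^k*odd zero    (suc f) {m} _         m-odd rewrite *-identityˡ m = v2-odd f m-odd
  v2-2^k*odd (suc k) (suc f) {m} (s≤s k<f) m-odd rewrite *-assoc 2 (2 ^ k) m =
    trans (v2-double f (2 ^ k * m)) (cong suc (v2-2^k*odd k f k<f m-odd))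

  ν₂ℕ-2^k*odd : ∀ k {m} → ¬ 2 ∣ m → ν₂ℕ (2 ^ k * m) ≡ k
  ν₂ℕ-2^k*odd k {zero}  m-odd = ⊥-elim (m-odd (2 ∣0))
  ν₂ℕ-2^k*odd k {suc m} m-odd =
    v2-2^k*odd k _ (<-≤-trans (n<2^n k) (m≤m*n (2 ^ k) (suc m))) m-odd

  2^k*odd-decomposition : ∀ {m} → m ≢ 0 → ∃₂ λ k o → ¬ 2 ∣ o × m ≡ 2 ^ k * o
  2^k*odd-decomposition {m} = go m (<-wellFounded m)
    where
    go : ∀ m → Acc _<_ m → m ≢ 0 → ∃₂ λ k o → ¬ 2 ∣ o × m ≡ 2 ^ k * o
    go m (acc rec) m≢0 with 2 ∣? m
    ... | no  m-odd = 0 , m , m-odd , sym (*-identityˡ m)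
    ... | yes (divides h refl) with go h (rec (m<m*n h 2 {{≢-nonZero h≢0}} (s≤s (s≤s z≤n)))) h≢0
      where
      h≢0 : h ≢ 0
      h≢0 h≡0 = m≢0 (cong (_* 2) h≡0)
    ...   | k , o , o-odd , refl = suc k , o , o-odd , rearrange (2 ^ k) o
      where
      rearrange : ∀ a b → a * b * 2 ≡ 2 * a * b
      rearrange = solve-∀

  ν₂ℕ-* : ∀ {m n} → m ≢ 0 → n ≢ 0 → ν₂ℕ (m * n) ≡ ν₂ℕ m + ν₂ℕ n
  ν₂ℕ-* m≢0 n≢0 with 2^k*odd-decomposition m≢0 | 2^k*odd-decomposition n≢0
  ... | i , o , o-odd , refl | j , o′ , o′-odd , refl = begin
    ν₂ℕ (2 ^ i * o * (2 ^ j * o′))   ≡⟨ cong ν₂ℕ (rearrange (2 ^ i) o (2 ^ j) o′) ⟩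
    ν₂ℕ (2 ^ i * 2 ^ j * (o * o′))   ≡⟨ cong (λ p → ν₂ℕ (p * (o * o′))) (sym (^-distribˡ-+-* 2 i j)) ⟩
    ν₂ℕ (2 ^ (i + j) * (o * o′))     ≡⟨ ν₂ℕ-2^k*odd (i + j) (odd*odd o-odd o′-odd) ⟩
    i + j                            ≡⟨ sym (cong₂ _+_ (ν₂ℕ-2^k*odd i o-odd) (ν₂ℕ-2^k*odd j o′-odd)) ⟩
    ν₂ℕ (2 ^ i * o) + ν₂ℕ (2 ^ j * o′) ∎
    where
    open ≡-Reasoning
    rearrange : ∀ a b c d → a * b * (c * d) ≡ a * c * (b * d)
    rearrange = solve-∀

  ν₂ℕ-odd : ∀ {m} → ¬ 2 ∣ m → ν₂ℕ m ≡ 0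
  ν₂ℕ-odd {m} m-odd = trans (cong ν₂ℕ (sym (*-identityˡ m))) (ν₂ℕ-2^k*odd 0 m-odd)

module Valuation where
  open Fractions
  open TwoAdicOrder
  open import Data.Integer using (ℤ; +_; +[1+_]; -[1+_]; _+_; _*_; _-_; ∣_∣; _≤_; +≤+)
  import Data.Integer.Properties as ℤP
  open import Data.Integer.Tactic.RingSolver using (solve-∀)
  import Data.Integer.Divisibility.Signed as Signed
  open import Data.Rational using (mkℚ; 0ℚ; ↥_; ↧_; ↧ₙ_)
  import Data.Nat as ℕ
  import Data.Nat.Divisibility as ℕ

  ν₂-numerator : ∀ x → ↥ x ≢ + 0 → ν₂ x ≡ just (+ (ν₂ℕ ∣ ↥ x ∣) - + ν₂ℕ (↧ₙ x))
  ν₂-numerator (mkℚ (+ 0)      _ _) ↥x≢0 = ⊥-elim (↥x≢0 refl)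
  ν₂-numerator (mkℚ +[1+ _ ] _ _) _    = refl
  ν₂-numerator (mkℚ -[1+ _ ] _ _) _    = refl

  ν₂≡just⇒≢0 : ∀ {x v} → ν₂ x ≡ just v → x ≢ 0ℚ
  ν₂≡just⇒≢0 () refl

  +-balance⇒-≡ : ∀ a b c e → a ℕ.+ b ≡ c ℕ.+ e → + a - + e ≡ + c - + b
  +-balance⇒-≡ a b c e eq = begin
    + a - + e                     ≡⟨ pad (+ a) (+ b) (+ e) ⟩
    (+ a + + b) - (+ b + + e)     ≡⟨ cong₂ _-_ (sym (ℤP.pos-+ a b)) (sym (ℤP.pos-+ b e)) ⟩
    + (a ℕ.+ b) - + (b ℕ.+ e)     ≡⟨ cong (λ s → + s - + (b ℕ.+ e)) eq ⟩
    + (c ℕ.+ e) - + (b ℕ.+ e)     ≡⟨ cong₂ _-_ (ℤP.pos-+ c e) (ℤP.pos-+ b e) ⟩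
    (+ c + + e) - (+ b + + e)     ≡⟨ sym (pad′ (+ c) (+ b) (+ e)) ⟩
    + c - + b                     ∎
    where
    open ≡-Reasoning
    pad : ∀ a b e → a - e ≡ (a + b) - (b + e)
    pad = solve-∀
    pad′ : ∀ c b e → c - b ≡ (c + e) - (b + e)
    pad′ = solve-∀

  ∣≢0 : ∀ {z} → z ≢ + 0 → ∣ z ∣ ≢ 0
  ∣≢0 z≢0 ∣z∣≡0 = z≢0 (ℤP.∣i∣≡0⇒i≡0 ∣z∣≡0)

  ν₂-fraction : ∀ {x n d} → x ≐ n ⁄ d → n ≢ + 0 →
                ν₂ x ≡ just (+ (ν₂ℕ ∣ n ∣) - + (ν₂ℕ ∣ d ∣))
  ν₂-fraction {x@(mkℚ N _ _)} {n} {d} x≐@(cross eq) n≢0 =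
    trans (ν₂-numerator x N≢0) (cong just (+-balance⇒-≡ (ν₂ℕ ∣ N ∣) (ν₂ℕ ∣ d ∣) (ν₂ℕ ∣ n ∣) (ν₂ℕ (↧ₙ x)) (begin
      ν₂ℕ ∣ N ∣ ℕ.+ ν₂ℕ ∣ d ∣        ≡⟨ sym (ν₂ℕ-* (∣≢0 N≢0) (∣≢0 (denominator≢0 x≐ n≢0))) ⟩
      ν₂ℕ (∣ N ∣ ℕ.* ∣ d ∣)          ≡⟨ cong ν₂ℕ (sym (ℤP.abs-* N d)) ⟩
      ν₂ℕ ∣ N * d ∣                  ≡⟨ cong (λ z → ν₂ℕ ∣ z ∣) eq ⟩
      ν₂ℕ ∣ n * ↧ x ∣                ≡⟨ cong ν₂ℕ (ℤP.abs-* n (↧ x)) ⟩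
      ν₂ℕ (∣ n ∣ ℕ.* ↧ₙ x)           ≡⟨ ν₂ℕ-* (∣≢0 n≢0) (λ ()) ⟩
      ν₂ℕ ∣ n ∣ ℕ.+ ν₂ℕ (↧ₙ x)       ∎)))
    where
    open ≡-Reasoning
    N≢0 : N ≢ + 0
    N≢0 = numerator≢0 x≐ n≢0

  Odd : ℤ → Set
  Odd z = ¬ 2 ℕ.∣ ∣ z ∣

  ∤-residue : ∀ {k} m a r → k ℕ.∣ m → ¬ k ℕ.∣ r → ¬ k ℕ.∣ ∣ + m * a + + r ∣
  ∤-residue {k} m a r k∣m k∤r k∣ =
    k∤r (Signed.∣⇒∣ᵤ (Signed.∣m+n∣m⇒∣n {+ k} {+ m * a} {+ r} (Signed.∣ᵤ⇒∣ k∣)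
                       (Signed.∣m⇒∣m*n {+ k} {+ m} a (Signed.∣ᵤ⇒∣ k∣m))))

  ∤⇒≢0 : ∀ {k z} → ¬ k ℕ.∣ ∣ z ∣ → z ≢ + 0
  ∤⇒≢0 {k} k∤ refl = k∤ (k ℕ.∣0)

  ν₂ℕ-∣2^k*odd∣ : ∀ k {e} → Odd e → ν₂ℕ ∣ + (2 ℕ.^ k) * e ∣ ≡ k
  ν₂ℕ-∣2^k*odd∣ k {e} e-odd = trans (cong ν₂ℕ (ℤP.abs-* (+ (2 ℕ.^ k)) e)) (ν₂ℕ-2^k*odd k e-odd)

  ν₂-odd⁄2^k*odd : ∀ k {x n e} → x ≐ n ⁄ + (2 ℕ.^ k) * e → Odd n → Odd e → ν₂ x ≡ just (+ 0 - + k)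
  ν₂-odd⁄2^k*odd k x≐ n-odd e-odd =
    trans (ν₂-fraction x≐ (∤⇒≢0 n-odd))
          (cong₂ (λ i j → just (+ i - + j)) (ν₂ℕ-odd n-odd) (ν₂ℕ-∣2^k*odd∣ k e-odd))

  ν₂-⁄odd : ∀ {x n e} → x ≐ n ⁄ e → n ≢ + 0 → Odd e → ∃ λ v → ν₂ x ≡ just v × + 0 ≤ v
  ν₂-⁄odd {n = n} x≐ n≢0 e-odd =
    _ , trans (ν₂-fraction x≐ n≢0) (cong (λ j → just (+ (ν₂ℕ ∣ n ∣) - + j)) (ν₂ℕ-odd e-odd)) ,
    subst (+ 0 ≤_) (sym (ℤP.+-identityʳ (+ ν₂ℕ ∣ n ∣))) (+≤+ ℕ.z≤n)

module Classes where
  open Fractions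
  open Valuation
  open import Data.Integer using (ℤ; +_; -[1+_]; _+_; _*_; -_; _-_; _≤_)
  import Data.Integer.Properties as ℤP
  open import Data.Integer.DivMod using (_%ℕ_; _/ℕ_; n%ℕd<d; a≡a%ℕn+[a/ℕn]*n)
  open import Data.Integer.Tactic.RingSolver using (solve-∀)
  open import Data.Rational as ℚ using (ℚ; 1ℚ)
  import Data.Nat as ℕ
  import Data.Nat.Divisibility as ℕ
  open import Relation.Nullary.Decidable using (from-no)
  open import Data.Sum using (_⊎_; inj₁; inj₂)

  odd-6a+1 : ∀ a → Odd (+ 6 * a + + 1)
  odd-6a+1 a = ∤-residue 6 a 1 (ℕ.divides 3 refl) (from-no (2 ℕ.∣? 1))

  FractionIn : (ℤ → ℤ) → (ℤ → ℤ) → ℚ → Set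
  FractionIn num den x = ∃₂ λ a b → x ≐ num a ⁄ den b

  Integral Unit Quarter : ℚ → Set
  Integral = FractionIn (λ a → + 3 * a + + 1) (λ b → + 6 * b + + 1)
  Unit     = FractionIn (λ a → + 6 * a + + 1) (λ b → + 6 * b + + 1)
  Quarter  = FractionIn (λ a → + 6 * a + + 5) (λ b → + 24 * b + + 4)

  -- Two residues of the numerator (mod 6) are needed: x + 1 - y is integral for Half x, y with the same one.
  data HalfResidue : Set where
    one three : HalfResidue

  residue : HalfResidue → ℕ.ℕ
  residue one   = 1
  residue three = 3

  opposite : HalfResidue → HalfResidue
  opposite one   = three
  opposite three = one

  Half : HalfResidue → ℚ → Set
  Half r = FractionIn (λ a → + 6 * a + + residue r) (λ b → + 12 * b + + 2)

  private
    [6a+1][6b+1] : ∀ a b → (+ 6 * a + + 1) * (+ 6 * b + + 1) ≡ + 6 * (+ 6 * a * b + a + b) + + 1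
    [6a+1][6b+1] = solve-∀

    [3a+1][6b+1] : ∀ a b → (+ 3 * a + + 1) * (+ 6 * b + + 1) ≡ + 3 * (+ 6 * a * b + a + + 2 * b) + + 1
    [3a+1][6b+1] = solve-∀

    [6a+c][6b+1] : ∀ c a b → (+ 6 * a + c) * (+ 6 * b + + 1) ≡ + 6 * (+ 6 * a * b + a + c * b) + c
    [6a+c][6b+1] = solve-∀

    [12a+2][6b+1] : ∀ a b → (+ 12 * a + + 2) * (+ 6 * b + + 1) ≡ + 12 * (+ 6 * a * b + a + b) + + 2
    [12a+2][6b+1] = solve-∀

    [24a+4][6b+1] : ∀ a b → (+ 24 * a + + 4) * (+ 6 * b + + 1) ≡ + 24 * (+ 6 * a * b + a + b) + + 4
    [24a+4][6b+1] = solve-∀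

  unit*unit : ∀ {x y} → Unit x → Unit y → Unit (x ℚ.* y)
  unit*unit (a , b , x≐) (a′ , b′ , y≐) =
    + 6 * a * a′ + a + a′ , + 6 * b * b′ + b + b′ ,
    ≐-resp ([6a+1][6b+1] a a′) ([6a+1][6b+1] b b′) (≐-* x≐ y≐)

  unit/unit : ∀ {x y} → Unit x → Unit y → Unit (x /' y)
  unit/unit (a , b , x≐) (a′ , b′ , y≐) =
    + 6 * a * b′ + a + b′ , + 6 * b * a′ + b + a′ ,
    ≐-resp ([6a+1][6b+1] a b′) ([6a+1][6b+1] b a′) (≐-/′ x≐ y≐ (∤⇒≢0 (odd-6a+1 a′)))

  2-unit : ∀ {x} → Unit x → Unit (2ℚ ℚ.- x)
  2-unit (a , b , x≐) = + 2 * b - a , b , ≐-resp (lemma a b) refl (≐-2- x≐)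
    where
    lemma : ∀ a b → + 2 * (+ 6 * b + + 1) - (+ 6 * a + + 1) ≡ + 6 * (+ 2 * b - a) + + 1
    lemma = solve-∀

  integral*unit : ∀ {x y} → Integral x → Unit y → Integral (x ℚ.* y)
  integral*unit (a , b , x≐) (a′ , b′ , y≐) =
    + 6 * a * a′ + a + + 2 * a′ , + 6 * b * b′ + b + b′ ,
    ≐-resp ([3a+1][6b+1] a a′) ([6a+1][6b+1] b b′) (≐-* x≐ y≐)

  integral/unit : ∀ {x y} → Integral x → Unit y → Integral (x /' y)
  integral/unit (a , b , x≐) (a′ , b′ , y≐) =
    + 6 * a * b′ + a + + 2 * b′ , + 6 * b * a′ + b + a′ ,
    ≐-resp ([3a+1][6b+1] a b′) ([6a+1][6b+1] b a′) (≐-/′ x≐ y≐ (∤⇒≢0 (odd-6a+1 a′)))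

  integral+1-integral : ∀ {x y} → Integral x → Integral y → Integral (x ℚ.+ 1ℚ ℚ.- y)
  integral+1-integral (a , b , x≐) (a′ , b′ , y≐) =
    + 6 * a * b′ + a + + 12 * b * b′ + + 4 * b′ - + 6 * a′ * b - a′ , + 6 * b * b′ + b + b′ ,
    ≐-resp (lemma a b a′ b′) ([6a+1][6b+1] b b′) (≐-+1- x≐ y≐)
    where
    lemma : ∀ a b a′ b′ →
      (+ 3 * a + + 1 + (+ 6 * b + + 1)) * (+ 6 * b′ + + 1) - (+ 3 * a′ + + 1) * (+ 6 * b + + 1)
        ≡ + 3 * (+ 6 * a * b′ + a + + 12 * b * b′ + + 4 * b′ - + 6 * a′ * b - a′) + + 1
    lemma = solve-∀

  reflect-integral : ∀ {x} → Integral x → Integral (reflect x)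
  reflect-integral (a , b , x≐) = - + 2 * b - a - + 1 , b , ≐-resp (lemma a b) refl (≐-reflect x≐)
    where
    lemma : ∀ a b → - (+ 6 * b + + 1) - (+ 3 * a + + 1) ≡ + 3 * (- + 2 * b - a - + 1) + + 1
    lemma = solve-∀

  parity : ∀ a → ∃ λ t → a ≡ + 2 * t ⊎ a ≡ + 2 * t + + 1
  parity a with a %ℕ 2 | n%ℕd<d a 2 | a≡a%ℕn+[a/ℕn]*n a 2
  ... | 0 | _ | a≡ = a /ℕ 2 , inj₁ (trans a≡ (lemma (a /ℕ 2)))
    where
    lemma : ∀ t → + 0 + t * + 2 ≡ + 2 * t
    lemma = solve-∀
  ... | 1 | _ | a≡ = a /ℕ 2 , inj₂ (trans a≡ (lemma (a /ℕ 2)))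
    where
    lemma : ∀ t → + 1 + t * + 2 ≡ + 2 * t + + 1
    lemma = solve-∀
  ... | ℕ.suc (ℕ.suc _) | ℕ.s≤s (ℕ.s≤s ()) | _

  private
    [6b+1]² : ∀ b → (+ 6 * b + + 1) * (+ 6 * b + + 1) ≡ + 6 * (+ 6 * b * b + + 2 * b) + + 1
    [6b+1]² = solve-∀

    [12b+2]² : ∀ b → (+ 12 * b + + 2) * (+ 12 * b + + 2) ≡ + 24 * (+ 6 * b * b + + 2 * b) + + 4
    [12b+2]² = solve-∀

  -- n² + n d - d² ≡ 1 (mod 6) for n ≡ 1 (mod 3), d ≡ 1 (mod 6), but the quotient depends on the parity of n.
  integral-quadratic : ∀ {x} → Integral x → Unit (quadratic x)
  integral-quadratic (a , b , x≐) with parity a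
  ... | t , inj₁ refl =
    + 6 * t * t + + 3 * t + + 6 * t * b - + 6 * b * b - b , + 6 * b * b + + 2 * b ,
    ≐-resp (lemma t b) ([6b+1]² b) (≐-quadratic x≐)
    where
    lemma : ∀ t b → let n = + 3 * (+ 2 * t) + + 1; d = + 6 * b + + 1 in
      n * n + n * d - d * d ≡ + 6 * (+ 6 * t * t + + 3 * t + + 6 * t * b - + 6 * b * b - b) + + 1
    lemma = solve-∀
  ... | t , inj₂ refl =
    + 6 * t * t + + 9 * t + + 6 * t * b + + 2 * b - + 6 * b * b + + 3 , + 6 * b * b + + 2 * b ,
    ≐-resp (lemma t b) ([6b+1]² b) (≐-quadratic x≐)
    where
    lemma : ∀ t b → let n = + 3 * (+ 2 * t + + 1) + + 1; d = + 6 * b + + 1 in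
      n * n + n * d - d * d ≡ + 6 * (+ 6 * t * t + + 9 * t + + 6 * t * b + + 2 * b - + 6 * b * b + + 3) + + 1
    lemma = solve-∀

  half+1-integral : ∀ {r x y} → Half r x → Integral y → Half r (x ℚ.+ 1ℚ ℚ.- y)
  half+1-integral {r} (a , b , x≐) (a′ , b′ , y≐) =
    + 6 * a * b′ + a + c * b′ + + 12 * b * b′ + + 2 * b′ - + 6 * a′ * b - a′ , + 6 * b * b′ + b + b′ ,
    ≐-resp (lemma c a b a′ b′) ([12a+2][6b+1] b b′) (≐-+1- x≐ y≐)
    where
    c : ℤ
    c = + residue r
    lemma : ∀ c a b a′ b′ →
      (+ 6 * a + c + (+ 12 * b + + 2)) * (+ 6 * b′ + + 1) - (+ 3 * a′ + + 1) * (+ 12 * b + + 2)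
        ≡ + 6 * (+ 6 * a * b′ + a + c * b′ + + 12 * b * b′ + + 2 * b′ - + 6 * a′ * b - a′) + c
    lemma = solve-∀

  half*unit : ∀ {r x y} → Half r x → Unit y → Half r (x ℚ.* y)
  half*unit {r} (a , b , x≐) (a′ , b′ , y≐) =
    + 6 * a * a′ + a + + residue r * a′ , + 6 * b * b′ + b + b′ ,
    ≐-resp ([6a+c][6b+1] (+ residue r) a a′) ([12a+2][6b+1] b b′) (≐-* x≐ y≐)

  half/unit : ∀ {r x y} → Half r x → Unit y → Half r (x /' y)
  half/unit {r} (a , b , x≐) (a′ , b′ , y≐) =
    + 6 * a * b′ + a + + residue r * b′ , + 6 * b * a′ + b + a′ ,
    ≐-resp ([6a+c][6b+1] (+ residue r) a b′) ([12a+2][6b+1] b a′) (≐-/′ x≐ y≐ (∤⇒≢0 (odd-6a+1 a′)))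

  reflect-half : ∀ r {x} → Half r x → Half (opposite r) (reflect x)
  reflect-half r (a , b , x≐) =
    - + 2 * b - a - + 1 , b ,
    ≐-resp (trans (lemma (+ residue r) a b) (cong (_+_ (+ 6 * (- + 2 * b - a - + 1))) (4-residue r))) refl
           (≐-reflect x≐)
    where
    4-residue : ∀ r → + 4 - + residue r ≡ + residue (opposite r)
    4-residue one   = refl
    4-residue three = refl
    lemma : ∀ c a b → - (+ 12 * b + + 2) - (+ 6 * a + c) ≡ + 6 * (- + 2 * b - a - + 1) + (+ 4 - c)
    lemma = solve-∀

  half+1-half : ∀ {r x y} → Half r x → Half r y → Integral (x ℚ.+ 1ℚ ℚ.- y)
  half+1-half {r} (a , b , x≐) (a′ , b′ , y≐) =
    + 6 * a * b′ + a + c * b′ + + 12 * b * b′ + + 2 * b + + 2 * b′ - + 6 * a′ * b - a′ - c * b ,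
    + 6 * b * b′ + b + b′ ,
    ≐-cancel (+ 4) (λ ()) (≐-resp (numerator c a b a′ b′) (denominator b b′) (≐-+1- x≐ y≐))
    where
    c : ℤ
    c = + residue r
    numerator : ∀ c a b a′ b′ →
      (+ 6 * a + c + (+ 12 * b + + 2)) * (+ 12 * b′ + + 2) - (+ 6 * a′ + c) * (+ 12 * b + + 2)
        ≡ + 4 * (+ 3 * (+ 6 * a * b′ + a + c * b′ + + 12 * b * b′ + + 2 * b + + 2 * b′ - + 6 * a′ * b - a′ - c * b) + + 1)
    numerator = solve-∀
    denominator : ∀ b b′ → (+ 12 * b + + 2) * (+ 12 * b′ + + 2) ≡ + 4 * (+ 6 * (+ 6 * b * b′ + b + b′) + + 1)
    denominator = solve-∀

  half-quadratic : ∀ r {x} → Half r x → Quarter (quadratic x)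
  half-quadratic one (a , b , x≐) =
    + 6 * a * a + + 4 * a + + 12 * a * b - + 24 * b * b - + 6 * b - + 1 , + 6 * b * b + + 2 * b ,
    ≐-resp (lemma a b) ([12b+2]² b) (≐-quadratic x≐)
    where
    lemma : ∀ a b → let n = + 6 * a + + 1; d = + 12 * b + + 2 in
      n * n + n * d - d * d ≡ + 6 * (+ 6 * a * a + + 4 * a + + 12 * a * b - + 24 * b * b - + 6 * b - + 1) + + 5
    lemma = solve-∀

  half-quadratic three (a , b , x≐) =
    + 6 * a * a + + 8 * a + + 12 * a * b - + 24 * b * b - + 2 * b + + 1 , + 6 * b * b + + 2 * b ,
    ≐-resp (lemma a b) ([12b+2]² b) (≐-quadratic x≐)
    where
    lemma : ∀ a b → let n = + 6 * a + + 3; d = + 12 * b + + 2 in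
      n * n + n * d - d * d ≡ + 6 * (+ 6 * a * a + + 8 * a + + 12 * a * b - + 24 * b * b - + 2 * b + + 1) + + 5
    lemma = solve-∀

  quarter*unit : ∀ {x y} → Quarter x → Unit y → Quarter (x ℚ.* y)
  quarter*unit (a , b , x≐) (a′ , b′ , y≐) =
    + 6 * a * a′ + a + + 5 * a′ , + 6 * b * b′ + b + b′ ,
    ≐-resp ([6a+c][6b+1] (+ 5) a a′) ([24a+4][6b+1] b b′) (≐-* x≐ y≐)

  quarter/quarter : ∀ {x y} → Quarter x → Quarter y → Unit (x /' y)
  quarter/quarter (a , b , x≐) (a′ , b′ , y≐) =
    - + 6 * a * b′ - a - + 5 * b′ - + 1 , - + 6 * b * a′ - + 5 * b - a′ - + 1 ,
    ≐-cancel (- + 4) (λ ()) (≐-resp (numerator a b′) (denominator b a′)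
                               (≐-/′ x≐ y≐ (∤⇒≢0 (∤-residue 6 a′ 5 (ℕ.divides 3 refl) (from-no (2 ℕ.∣? 5))))))
    where
    numerator : ∀ a b′ → (+ 6 * a + + 5) * (+ 24 * b′ + + 4) ≡ - + 4 * (+ 6 * (- + 6 * a * b′ - a - + 5 * b′ - + 1) + + 1)
    numerator = solve-∀
    denominator : ∀ b a′ → (+ 24 * b + + 4) * (+ 6 * a′ + + 5) ≡ - + 4 * (+ 6 * (- + 6 * b * a′ - + 5 * b - a′ - + 1) + + 1)
    denominator = solve-∀

  1-integral : Integral 1ℚ
  1-integral = + 0 , + 0 , cross refl

  1-unit : Unit 1ℚ
  1-unit = + 0 , + 0 , cross refl

  unit-ν₂ : ∀ {x} → Unit x → ν₂ x ≡ just (+ 0)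
  unit-ν₂ (a , b , x≐) =
    ν₂-odd⁄2^k*odd 0 (≐-resp refl (sym (ℤP.*-identityˡ _)) x≐) (odd-6a+1 a) (odd-6a+1 b)

  integral-ν₂ : ∀ {x} → Integral x → ∃ λ v → ν₂ x ≡ just v × + 0 ≤ v
  integral-ν₂ (a , b , x≐) =
    ν₂-⁄odd x≐ (∤⇒≢0 (∤-residue 3 a 1 ℕ.∣-refl (from-no (3 ℕ.∣? 1)))) (odd-6a+1 b)

  half-ν₂ : ∀ r {x} → Half r x → ν₂ x ≡ just -[1+ 0 ]
  half-ν₂ r (a , b , x≐) =
    ν₂-odd⁄2^k*odd 1 (≐-resp refl (lemma b) x≐) (∤-residue 6 a (residue r) (ℕ.divides 3 refl) (residue-odd r))
                     (odd-6a+1 b)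
    where
    residue-odd : ∀ r → ¬ 2 ℕ.∣ residue r
    residue-odd one   = from-no (2 ℕ.∣? 1)
    residue-odd three = from-no (2 ℕ.∣? 3)
    lemma : ∀ b → + 12 * b + + 2 ≡ + 2 * (+ 6 * b + + 1)
    lemma = solve-∀

  quarter-ν₂ : ∀ {x} → Quarter x → ν₂ x ≡ just -[1+ 1 ]
  quarter-ν₂ (a , b , x≐) =
    ν₂-odd⁄2^k*odd 2 (≐-resp refl (lemma b) x≐) (∤-residue 6 a 5 (ℕ.divides 3 refl) (from-no (2 ℕ.∣? 5)))
                     (odd-6a+1 b)
    where
    lemma : ∀ b → + 24 * b + + 4 ≡ + 4 * (+ 6 * b + + 1)
    lemma = solve-∀

open Fractions using (cross)
open Valuation using (ν₂≡just⇒≢0)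
open Classes

open import Data.Nat using (ℕ; zero; suc; _≤_; _<_; _^_; _+_; _*_; _/_; _%_; z≤n; s≤s; _≟_)
open import Data.Nat.Properties
  using (+-comm; +-cancelˡ-≡; *-cancelʳ-≡; *-cancelʳ-<; *-comm; suc-injective; 1+n≢n; n<1+n; <-trans;
         m≤n+m; m≢1+n+m; <-≤-trans; +-monoˡ-≤)
open import Data.Nat.DivMod using (m≡m%n+[m/n]*n; m%n<n; [m+kn]%n≡m%n; m<n⇒m%n≡m; m*n/n≡m)
open import Data.Nat.Tactic.RingSolver using (solve-∀)
open import Data.Integer using (ℤ; +_; -[1+_]) renaming (_≤_ to _≤ℤ_)
open import Data.Rational using (ℚ; 0ℚ)
open import Data.Sum using (_⊎_; inj₁; inj₂; [_,_])
open import Function.Base using (_∘_)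
open import Function.Bundles using (_⇔_; mk⇔)

-- Block m of a level holds the entries 3m+1, 3m+2, 3m+3; mid ℓ = (3^ℓ - 1)/2 is the block holding M₁ ℓ and M₂ ℓ.

mid : ℕ → ℕ
mid zero    = 0
mid (suc ℓ) = suc (mid ℓ * 3)

M₁ M₂ : ℕ → ℕ
M₁ ℓ = 2 + mid ℓ * 3
M₂ ℓ = 3 + mid ℓ * 3

1+mid*2≡3^ : ∀ ℓ → 1 + mid ℓ * 2 ≡ 3 ^ ℓ
1+mid*2≡3^ zero    = refl
1+mid*2≡3^ (suc ℓ) = trans (lemma (mid ℓ)) (cong (3 *_) (1+mid*2≡3^ ℓ))
  where
  lemma : ∀ m → 1 + suc (m * 3) * 2 ≡ 3 * (1 + m * 2)
  lemma = solve-∀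

middle-index : ∀ ℓ i → (3 ^ suc ℓ + (1 + i * 2)) / 2 ≡ 2 + i + mid ℓ * 3
middle-index ℓ i = begin
  (3 ^ suc ℓ + (1 + i * 2)) / 2            ≡⟨ cong (λ t → (3 * t + (1 + i * 2)) / 2) (sym (1+mid*2≡3^ ℓ)) ⟩
  (3 * (1 + mid ℓ * 2) + (1 + i * 2)) / 2  ≡⟨ cong (_/ 2) (lemma (mid ℓ) i) ⟩
  (2 + i + mid ℓ * 3) * 2 / 2              ≡⟨ m*n/n≡m (2 + i + mid ℓ * 3) 2 ⟩
  2 + i + mid ℓ * 3                        ∎
  where
  open ≡-Reasoning
  lemma : ∀ m i → 3 * (1 + m * 2) + (1 + i * 2) ≡ (2 + i + m * 3) * 2
  lemma = solve-∀

M₁-closed-form : ∀ ℓ → (3 ^ suc ℓ + 1) / 2 ≡ M₁ ℓ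
M₁-closed-form ℓ = middle-index ℓ 0

M₂-closed-form : ∀ ℓ → (3 ^ suc ℓ + 3) / 2 ≡ M₂ ℓ
M₂-closed-form ℓ = middle-index ℓ 1

remainder-of : ∀ r m → r < 3 → (r + m * 3) % 3 ≡ r
remainder-of r m r<3 = trans ([m+kn]%n≡m%n r m 3) (m<n⇒m%n≡m r<3)

quotient-of : ∀ r m → r < 3 → (r + m * 3) / 3 ≡ m
quotient-of r m r<3 = *-cancelʳ-≡ _ _ 3 (+-cancelˡ-≡ r _ _ (sym (begin
  r + m * 3                              ≡⟨ m≡m%n+[m/n]*n (r + m * 3) 3 ⟩
  (r + m * 3) % 3 + (r + m * 3) / 3 * 3  ≡⟨ cong (_+ (r + m * 3) / 3 * 3) (remainder-of r m r<3) ⟩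
  r + (r + m * 3) / 3 * 3                ∎)))
  where open ≡-Reasoning

quotient-unique : ∀ {r m r′ m′} → r < 3 → r′ < 3 → r + m * 3 ≡ r′ + m′ * 3 → m ≡ m′
quotient-unique {r} {m} {r′} {m′} r<3 r′<3 eq =
  trans (sym (quotient-of r m r<3)) (trans (cong (_/ 3) eq) (quotient-of r′ m′ r′<3))

division-by-3 : ∀ n → ∃₂ λ r m → r < 3 × n ≡ r + m * 3
division-by-3 n = n % 3 , n / 3 , m%n<n n 3 , m≡m%n+[m/n]*n n 3

αAt-block : ∀ F r m → r < 3 → αAt F (suc (r + m * 3)) ≡ aAt (F m) r
αAt-block F r m r<3 = cong₂ (λ k s → aAt (F k) s) (quotient-of r m r<3) (remainder-of r m r<3)

βAt-block : ∀ F r m → r < 3 → βAt F (suc (r + m * 3)) ≡ bAt (F m) r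
βAt-block F r m r<3 = cong₂ (λ k s → bAt (F k) s) (quotient-of r m r<3) (remainder-of r m r<3)

block<3^ : ∀ ℓ r m → suc (r + m * 3) ≤ 3 ^ suc ℓ → m < 3 ^ ℓ
block<3^ ℓ r m j≤ =
  *-cancelʳ-< 3 m (3 ^ ℓ) (<-≤-trans (s≤s (m≤n+m (m * 3) r)) (subst (suc (r + m * 3) ≤_) (*-comm 3 (3 ^ ℓ)) j≤))

record GenericBlock (B : Blk) : Set where
  field
    integral₁ : Integral (a₁ B)
    integral₂ : Integral (a₂ B)
    integral₃ : Integral (a₃ B)
    unit₁     : Unit (b₁ B)
    unit₂     : Unit (b₂ B)
    unit₃     : Unit (b₃ B)

record MiddleBlock (r : HalfResidue) (B : Blk) : Set where
  field
    integral₁ : Integral (a₁ B)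
    half₂     : Half r (a₂ B)
    half₃     : Half (opposite r) (a₃ B)
    unit₁     : Unit (b₁ B)
    unit₂     : Unit (b₂ B)
    quarter₃  : Quarter (b₃ B)

open GenericBlock
open MiddleBlock

generic-entry : ∀ {B} → GenericBlock B → ∀ r → Integral (aAt B r) × Unit (bAt B r)
generic-entry G 0             = integral₁ G , unit₁ G
generic-entry G 1             = integral₂ G , unit₂ G
generic-entry G (suc (suc _)) = integral₃ G , unit₃ G

step-generic : ∀ {B a′ b′} → GenericBlock B → Integral a′ → Unit b′ → GenericBlock (step B a′ b′)
step-generic {B} {a′} {b′} G α′ β′ = record
  { integral₁ = 1-integral ; integral₂ = α₅ ; integral₃ = reflect-integral α₅
  ; unit₁ = β₄ ; unit₂ = 2-unit β₄ ; unit₃ = integral-quadratic α₅ }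
  where
  β₄ : Unit (b₁ (step B a′ b′))
  β₄ = unit/unit β′ (unit*unit (unit₃ G) (unit₂ G))
  α₅ : Integral (a₂ (step B a′ b′))
  α₅ = reflect-integral (integral/unit (integral+1-integral α′ (integral*unit (integral₂ G) β₄)) (2-unit β₄))

step-into-middle : ∀ {B a′ b′ r} → GenericBlock B → Half r a′ → Unit b′ → MiddleBlock (opposite r) (step B a′ b′)
step-into-middle {B} {a′} {b′} {r} G α′ β′ = record
  { integral₁ = 1-integral ; half₂ = α₅ ; half₃ = reflect-half (opposite r) α₅
  ; unit₁ = β₄ ; unit₂ = 2-unit β₄ ; quarter₃ = half-quadratic (opposite r) α₅ }
  where
  β₄ : Unit (b₁ (step B a′ b′))
  β₄ = unit/unit β′ (unit*unit (unit₃ G) (unit₂ G))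
  α₅ : Half (opposite r) (a₂ (step B a′ b′))
  α₅ = reflect-half r (half/unit (half+1-integral α′ (integral*unit (integral₂ G) β₄)) (2-unit β₄))

step-out-of-middle : ∀ {B a′ b′ r} → MiddleBlock r B → Half r a′ → Quarter b′ → GenericBlock (step B a′ b′)
step-out-of-middle {B} {a′} {b′} M α′ β′ = record
  { integral₁ = 1-integral ; integral₂ = α₅ ; integral₃ = reflect-integral α₅
  ; unit₁ = β₄ ; unit₂ = 2-unit β₄ ; unit₃ = integral-quadratic α₅ }
  where
  β₄ : Unit (b₁ (step B a′ b′))
  β₄ = quarter/quarter β′ (quarter*unit (quarter₃ M) (unit₂ M))
  α₅ : Integral (a₂ (step B a′ b′))
  α₅ = reflect-integral (integral/unit (half+1-half α′ (half*unit (half₂ M) β₄)) (2-unit β₄))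

-- The residue of α_{M₁} at level ℓ; ρ 0 = three because α^{(0)}_2 = -3/2.
ρ : ℕ → HalfResidue
ρ zero    = three
ρ (suc ℓ) = opposite (ρ ℓ)

record EntryClasses (ℓ j : ℕ) (a b : ℚ) : Set where
  field
    at-M₁     : j ≡ M₁ ℓ → Half (ρ ℓ) a × Unit b
    at-M₂     : j ≡ M₂ ℓ → Half (opposite (ρ ℓ)) a × Quarter b
    elsewhere : j ≢ M₁ ℓ → j ≢ M₂ ℓ → Integral a × Unit b

open EntryClasses

-- Entries 1 and 2 are excluded: β_2 = 2 belongs to no class.
EntryInvariant : ℕ → Set
EntryInvariant ℓ = ∀ j → 3 ≤ j → j ≤ 3 ^ suc ℓ → EntryClasses ℓ j (α ℓ j) (β ℓ j)

record BlockClasses (ℓ m : ℕ) : Set where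
  field
    off-middle : m ≢ mid ℓ → GenericBlock (levels ℓ m)
    middle     : m ≡ mid ℓ → MiddleBlock (ρ ℓ) (levels ℓ m)

open BlockClasses

entries-level-0 : EntryInvariant 0
entries-level-0 1 (s≤s ()) _
entries-level-0 2 (s≤s (s≤s ())) _
entries-level-0 3 _ _ = record
  { at-M₁     = λ ()
  ; at-M₂     = λ _ → (+ 0 , + 0 , cross refl) , (-[1+ 0 ] , + 0 , cross refl)
  ; elsewhere = λ _ 3≢3 → ⊥-elim (3≢3 refl) }
entries-level-0 (suc (suc (suc (suc _)))) _ (s≤s (s≤s (s≤s ())))

-- Block 1 is computed from β_2 = 2 of the previous level, so it is checked directly.
block-1 : ∀ ℓ → BlockClasses (suc ℓ) 1
block-1 zero = record
  { off-middle = λ 1≢1 → ⊥-elim (1≢1 refl)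
  ; middle     = λ _ → record
    { integral₁ = 1-integral
    ; half₂     = -[1+ 0 ] , + 0 , cross refl
    ; half₃     = + 0 , + 0 , cross refl
    ; unit₁     = 1-unit
    ; unit₂     = 1-unit
    ; quarter₃  = + 1 , + 0 , cross refl } }
block-1 (suc ℓ) = record
  { off-middle = λ _ → record
    { integral₁ = 1-integral
    ; integral₂ = -[1+ 0 ] , + 0 , cross refl
    ; integral₃ = 1-integral
    ; unit₁     = 1-unit
    ; unit₂     = 1-unit
    ; unit₃     = 1-unit }
  ; middle     = λ () }

parent-entry : ∀ {ℓ m} → EntryInvariant ℓ → 1 ≤ m → suc m < 3 ^ suc ℓ →
               EntryClasses ℓ (m + 2) (α ℓ (m + 2)) (β ℓ (m + 2))
parent-entry {ℓ} {m} entries 1≤m m+1<3^ =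
  entries (m + 2) (+-monoˡ-≤ 2 1≤m) (subst (_≤ 3 ^ suc ℓ) (sym (+-comm m 2)) m+1<3^)

-- Entry m+2 of level ℓ is M₁ ℓ exactly when m+1 = mid (ℓ+1), and M₂ ℓ exactly when m = mid (ℓ+1).
block-step : ∀ {ℓ m} → EntryInvariant ℓ → 1 ≤ m → suc m < 3 ^ suc ℓ →
             BlockClasses (suc ℓ) m → BlockClasses (suc ℓ) (suc m)
block-step {ℓ} {m} entries 1≤m m+1<3^ blocks with suc m ≟ mid (suc ℓ) | m ≟ mid (suc ℓ)
... | yes m+1≡mid | _ = record
  { off-middle = λ m+1≢mid → ⊥-elim (m+1≢mid m+1≡mid)
  ; middle     = λ _ → step-into-middle (off-middle blocks m≢mid) (proj₁ half-unit) (proj₂ half-unit) }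
  where
  m≢mid : m ≢ mid (suc ℓ)
  m≢mid m≡mid = 1+n≢n (trans m+1≡mid (sym m≡mid))
  half-unit : Half (ρ ℓ) (α ℓ (m + 2)) × Unit (β ℓ (m + 2))
  half-unit = at-M₁ (parent-entry entries 1≤m m+1<3^) (trans (+-comm m 2) (cong suc m+1≡mid))
... | no m+1≢mid | yes m≡mid = record
  { off-middle = λ _ → step-out-of-middle (middle blocks m≡mid) (proj₁ half-quarter) (proj₂ half-quarter)
  ; middle     = λ m+1≡mid → ⊥-elim (m+1≢mid m+1≡mid) }
  where
  half-quarter : Half (opposite (ρ ℓ)) (α ℓ (m + 2)) × Quarter (β ℓ (m + 2))
  half-quarter = at-M₂ (parent-entry entries 1≤m m+1<3^) (trans (+-comm m 2) (cong (λ k → suc (suc k)) m≡mid))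
... | no m+1≢mid | no m≢mid = record
  { off-middle = λ _ → step-generic (off-middle blocks m≢mid) (proj₁ integral-unit) (proj₂ integral-unit)
  ; middle     = λ m+1≡mid → ⊥-elim (m+1≢mid m+1≡mid) }
  where
  integral-unit : Integral (α ℓ (m + 2)) × Unit (β ℓ (m + 2))
  integral-unit = elsewhere (parent-entry entries 1≤m m+1<3^)
    (λ e → m+1≢mid (suc-injective (trans (sym (+-comm m 2)) e)))
    (λ e → m≢mid (suc-injective (suc-injective (trans (sym (+-comm m 2)) e))))

blocks : ∀ {ℓ} → EntryInvariant ℓ → ∀ m → 1 ≤ m → m < 3 ^ suc ℓ → BlockClasses (suc ℓ) m
blocks {ℓ} entries 1             _ _       = block-1 ℓ
blocks entries     (suc (suc m)) _ m+2<3^ =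
  block-step entries (s≤s z≤n) m+2<3^ (blocks entries (suc m) (s≤s z≤n) (<-trans (n<1+n (suc m)) m+2<3^))

middle-block-entry : ∀ {ℓ B} r → r < 3 → MiddleBlock (ρ ℓ) B →
                     EntryClasses ℓ (suc (r + mid ℓ * 3)) (aAt B r) (bAt B r)
middle-block-entry {ℓ} 0 _ M = record
  { at-M₁     = λ e → ⊥-elim (1+n≢n (sym (suc-injective e)))
  ; at-M₂     = λ e → ⊥-elim (m≢1+n+m (mid ℓ * 3) {1} (suc-injective e))
  ; elsewhere = λ _ _ → integral₁ M , unit₁ M }
middle-block-entry {ℓ} 1 _ M = record
  { at-M₁     = λ _ → half₂ M , unit₂ M
  ; at-M₂     = λ e → ⊥-elim (1+n≢n (sym (suc-injective e)))
  ; elsewhere = λ j≢M₁ _ → ⊥-elim (j≢M₁ refl) }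
middle-block-entry {ℓ} 2 _ M = record
  { at-M₁     = λ e → ⊥-elim (1+n≢n e)
  ; at-M₂     = λ _ → half₃ M , quarter₃ M
  ; elsewhere = λ _ j≢M₂ → ⊥-elim (j≢M₂ refl) }
middle-block-entry (suc (suc (suc _))) (s≤s (s≤s (s≤s ()))) _

generic-block-entry : ∀ {ℓ m B r} → r < 3 → m ≢ mid ℓ → GenericBlock B →
                      EntryClasses ℓ (suc (r + m * 3)) (aAt B r) (bAt B r)
generic-block-entry {r = r} r<3 m≢mid G = record
  { at-M₁     = λ e → ⊥-elim (m≢mid (quotient-unique r<3 (s≤s (s≤s z≤n)) (suc-injective e)))
  ; at-M₂     = λ e → ⊥-elim (m≢mid (quotient-unique r<3 (s≤s (s≤s (s≤s z≤n))) (suc-injective e)))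
  ; elsewhere = λ _ _ → generic-entry G r }

block-entry : ∀ {ℓ m r} → r < 3 → BlockClasses ℓ m →
              EntryClasses ℓ (suc (r + m * 3)) (aAt (levels ℓ m) r) (bAt (levels ℓ m) r)
block-entry {ℓ} {m} {r} r<3 classes with m ≟ mid ℓ
... | yes refl  = middle-block-entry r r<3 (middle classes refl)
... | no m≢mid = generic-block-entry r<3 m≢mid (off-middle classes m≢mid)

entry-from-blocks : ∀ {ℓ} → (∀ m → 1 ≤ m → m < 3 ^ suc ℓ → BlockClasses (suc ℓ) m) →
                    ∀ r m → r < 3 → 3 ≤ suc (r + m * 3) → suc (r + m * 3) ≤ 3 ^ suc (suc ℓ) →
                    EntryClasses (suc ℓ) (suc (r + m * 3)) (α (suc ℓ) (suc (r + m * 3))) (β (suc ℓ) (suc (r + m * 3)))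
entry-from-blocks _ 0 zero _ (s≤s ()) _
entry-from-blocks _ 1 zero _ (s≤s (s≤s ())) _
entry-from-blocks _ 2 zero _ _ _ = record
  { at-M₁     = λ ()
  ; at-M₂     = λ ()
  ; elsewhere = λ _ _ → 1-integral , 1-unit }
entry-from-blocks _ (suc (suc (suc _))) zero (s≤s (s≤s (s≤s ()))) _ _
entry-from-blocks {ℓ} classes r (suc m) r<3 _ j≤ =
  subst₂ (EntryClasses (suc ℓ) (suc (r + suc m * 3)))
         (sym (αAt-block (levels (suc ℓ)) r (suc m) r<3)) (sym (βAt-block (levels (suc ℓ)) r (suc m) r<3))
         (block-entry r<3 (classes (suc m) (s≤s z≤n) (block<3^ (suc ℓ) r (suc m) j≤)))

blocks⇒entries : ∀ {ℓ} → (∀ m → 1 ≤ m → m < 3 ^ suc ℓ → BlockClasses (suc ℓ) m) → EntryInvariant (suc ℓ)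
blocks⇒entries classes (suc n) 3≤j j≤ with division-by-3 n
... | r , m , r<3 , refl = entry-from-blocks classes r m r<3 3≤j j≤

entries : ∀ ℓ → EntryInvariant ℓ
entries zero    = entries-level-0
entries (suc ℓ) = blocks⇒entries (blocks (entries ℓ))

AlphaConclusion : ℚ → ℕ → ℕ → ℕ → Set
AlphaConclusion x j m₁ m₂ =
  ((ν₂ x ≡ just -[1+ 0 ]) ⇔ (j ≡ m₁ ⊎ j ≡ m₂)) ×
  (¬ (j ≡ m₁ ⊎ j ≡ m₂) → x ≢ 0ℚ × ∃ λ v → ν₂ x ≡ just v × + 0 ≤ℤ v)

BetaConclusion : ℚ → ℕ → ℕ → Set
BetaConclusion y j m₂ =
  ((ν₂ y ≡ just -[1+ 1 ]) ⇔ (j ≡ m₂)) × (j ≢ 2 → j ≢ m₂ → ν₂ y ≡ just (+ 0)) × y ≢ 0ℚ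

α-conclusion-half : ∀ {x j m₁ m₂} → ν₂ x ≡ just -[1+ 0 ] → j ≡ m₁ ⊎ j ≡ m₂ → AlphaConclusion x j m₁ m₂
α-conclusion-half ν≡-1 j∈ = mk⇔ (λ _ → j∈) (λ _ → ν≡-1) , λ j∉ → ⊥-elim (j∉ j∈)

α-conclusion-integral : ∀ {x j m₁ m₂} → Integral x → j ≢ m₁ → j ≢ m₂ → AlphaConclusion x j m₁ m₂
α-conclusion-integral x-integral j≢m₁ j≢m₂ with integral-ν₂ x-integral
... | v , ν≡v , 0≤v =
  mk⇔ (λ ν≡-1 → ⊥-elim (nonnegative (trans (sym ν≡v) ν≡-1) 0≤v)) [ ⊥-elim ∘ j≢m₁ , ⊥-elim ∘ j≢m₂ ] ,
  λ _ → ν₂≡just⇒≢0 ν≡v , v , ν≡v , 0≤v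
  where
  nonnegative : ∀ {v} → just v ≡ just -[1+ 0 ] → ¬ + 0 ≤ℤ v
  nonnegative refl ()

β-conclusion-unit : ∀ {y j m₂} → Unit y → j ≢ m₂ → BetaConclusion y j m₂
β-conclusion-unit {y} y-unit j≢m₂ =
  mk⇔ (λ ν≡-2 → ⊥-elim (0≢-2 (trans (sym ν≡0) ν≡-2))) (⊥-elim ∘ j≢m₂) , (λ _ _ → ν≡0) , ν₂≡just⇒≢0 ν≡0
  where
  ν≡0 : ν₂ y ≡ just (+ 0)
  ν≡0 = unit-ν₂ y-unit
  0≢-2 : just (+ 0) ≢ just -[1+ 1 ]
  0≢-2 ()

β-conclusion-two : ∀ {y j m₂} → ν₂ y ≡ just (+ 1) → j ≡ 2 → j ≢ m₂ → BetaConclusion y j m₂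
β-conclusion-two ν≡1 j≡2 j≢m₂ =
  mk⇔ (λ ν≡-2 → ⊥-elim (1≢-2 (trans (sym ν≡1) ν≡-2))) (⊥-elim ∘ j≢m₂) , (λ j≢2 _ → ⊥-elim (j≢2 j≡2)) ,
  ν₂≡just⇒≢0 ν≡1
  where
  1≢-2 : just (+ 1) ≢ just -[1+ 1 ]
  1≢-2 ()

β-conclusion-quarter : ∀ {y j m₂} → Quarter y → j ≡ m₂ → BetaConclusion y j m₂
β-conclusion-quarter y-quarter j≡m₂ =
  mk⇔ (λ _ → j≡m₂) (λ _ → quarter-ν₂ y-quarter) , (λ _ j≢m₂ → ⊥-elim (j≢m₂ j≡m₂)) ,
  ν₂≡just⇒≢0 (quarter-ν₂ y-quarter)

entry-conclusions : ∀ {ℓ j} → EntryClasses ℓ j (α ℓ j) (β ℓ j) →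
                    AlphaConclusion (α ℓ j) j (M₁ ℓ) (M₂ ℓ) × BetaConclusion (β ℓ j) j (M₂ ℓ)
entry-conclusions {ℓ} {j} classes with j ≟ M₁ ℓ | j ≟ M₂ ℓ
... | yes j≡M₁ | _ =
  α-conclusion-half (half-ν₂ (ρ ℓ) (proj₁ half-unit)) (inj₁ j≡M₁) ,
  β-conclusion-unit (proj₂ half-unit) (λ j≡M₂ → 1+n≢n (trans (sym j≡M₂) j≡M₁))
  where
  half-unit : Half (ρ ℓ) (α ℓ j) × Unit (β ℓ j)
  half-unit = at-M₁ classes j≡M₁
... | no _ | yes j≡M₂ =
  α-conclusion-half (half-ν₂ (opposite (ρ ℓ)) (proj₁ half-quarter)) (inj₂ j≡M₂) ,
  β-conclusion-quarter (proj₂ half-quarter) j≡M₂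
  where
  half-quarter : Half (opposite (ρ ℓ)) (α ℓ j) × Quarter (β ℓ j)
  half-quarter = at-M₂ classes j≡M₂
... | no j≢M₁ | no j≢M₂ =
  α-conclusion-integral (proj₁ integral-unit) j≢M₁ j≢M₂ , β-conclusion-unit (proj₂ integral-unit) j≢M₂
  where
  integral-unit : Integral (α ℓ j) × Unit (β ℓ j)
  integral-unit = elsewhere classes j≢M₁ j≢M₂

conclusions : ∀ ℓ j → 1 ≤ j → j ≤ 3 ^ suc ℓ →
              AlphaConclusion (α ℓ j) j (M₁ ℓ) (M₂ ℓ) × BetaConclusion (β ℓ j) j (M₂ ℓ)
conclusions zero    1 _ _ = α-conclusion-integral 1-integral (λ ()) (λ ()) , β-conclusion-unit 1-unit (λ ())
conclusions (suc ℓ) 1 _ _ = α-conclusion-integral 1-integral (λ ()) (λ ()) , β-conclusion-unit 1-unit (λ ())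
conclusions zero    2 _ _ = α-conclusion-half refl (inj₁ refl) , β-conclusion-two refl refl (λ ())
conclusions (suc ℓ) 2 _ _ =
  α-conclusion-integral (-[1+ 0 ] , + 0 , cross refl) (λ ()) (λ ()) , β-conclusion-two refl refl (λ ())
conclusions ℓ j@(suc (suc (suc _))) _ j≤ = entry-conclusions (entries ℓ j (s≤s (s≤s (s≤s z≤n))) j≤)

β₂-valuation : ∀ ℓ → ν₂ (β ℓ 2) ≡ just (+ 1)
β₂-valuation zero    = refl
β₂-valuation (suc ℓ) = refl

proposition4p1 : (ℓ j : ℕ) → 1 ≤ j → j ≤ 3 ^ suc ℓ →
    ((ν₂ (α ℓ j) ≡ just -[1+ 0 ]) ⇔ (j ≡ (3 ^ suc ℓ + 1) / 2 ⊎ j ≡ (3 ^ suc ℓ + 3) / 2))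
    × (¬ (j ≡ (3 ^ suc ℓ + 1) / 2 ⊎ j ≡ (3 ^ suc ℓ + 3) / 2) →
        α ℓ j ≢ 0ℚ × ∃ λ v → ν₂ (α ℓ j) ≡ just v × + 0 ≤ℤ v)
    × ν₂ (β ℓ 2) ≡ just (+ 1)
    × ((ν₂ (β ℓ j) ≡ just -[1+ 1 ]) ⇔ (j ≡ (3 ^ suc ℓ + 3) / 2))
    × (j ≢ 2 → j ≢ (3 ^ suc ℓ + 3) / 2 → ν₂ (β ℓ j) ≡ just (+ 0))
    × β ℓ j ≢ 0ℚ
proposition4p1 ℓ j 1≤j j≤3^ rewrite M₁-closed-form ℓ | M₂-closed-form ℓ =
  let (α-half⇔ , α-integral) , (β-quarter⇔ , β-unit , β≢0) = conclusions ℓ j 1≤j j≤3^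
  in α-half⇔ , α-integral , β₂-valuation ℓ , β-quarter⇔ , β-unit , β≢0
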